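{- Let $m\ge1$. - It is decidable whether a finite set $\Theta=\{\theta_1,\dots,\theta_k\}\subseteq\mathsf{FORM}_m$ is incompatible. - There is a Turing machine that, given a compatible set $\Theta=\{\theta_1,\dots,\theta_k\}\subseteq\mathsf{FORM}_m$, outputs a formula $\omega\in\mathsf{FORM}_m$ with $\hat\omega=\hat\theta_1\sqcap\dots\sqcap\hat\theta_k$, where $\sqcap$ is applied pointwise.
   Context: Let $\mathfrak Z=\{0,1/2,1\}$, with the following binary operations. - $x\wedge y=\min(x,y)$. - $x\sqcup y=x$ if $x=y$, and $x\sqcup y=1/2$ otherwise. - $\partial(x,y)=1/2$ if $y=1/2$. If $y\in\{0,1\}$, then $\partial(x,y)=y$ when $x=y$, and $\partial(x,y)=1-y$ when $x\ne y$. - The partial operation $\sqcap$: $x\sqcap x=x$, $x\sqcap1/2=1/2\sqcap x=x$, and $0\sqcap1$, $1\sqcap0$ are undefined. $\mathsf{FORM}_m$ is the set of formulas in variables $X_1,\dots,X_m$ and constants $0,1/2$ built with $\sqcup,\partial,\wedge$. Each formula gives $\hat\phi\colon\mathfrak Z^m\to\mathfrak Z$. $\Theta$ is incompatible if for some $v\in\mathfrak Z^m$ and $\theta_1,\theta_2\in\Theta$ one has $\{\hat\theta_1(v),\hat\theta_2(v)\}=\{0,1\}$; otherwise it is compatible. For compatible $\Theta$ the pointwise $\sqcap$ of the $\hat\theta_i$ is everywhere defined. -}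

module Defs where

open import Data.Nat using (ℕ)
open import Data.Fin using (Fin)
open import Data.Maybe using (Maybe; just; nothing; _>>=_)
open import Data.List.NonEmpty using (List⁺; _∷_; toList)
open import Data.List using (List; []; _∷_)
open import Data.List.Membership.Propositional using (_∈_)
open import Data.Product using (∃; Σ; _×_; ∃-syntax)
open import Data.Sum using (_⊎_)
open import Relation.Binary.PropositionalEquality using (_≡_)
open import Relation.Nullary using (¬_)

data Z : Set where
  z0 half z1 : Z

_∧_ : Z → Z → Z
z0   ∧ y    = z0
half ∧ z0   = z0
half ∧ y    = half
z1   ∧ y    = y

_⊔_ : Z → Z → Z
z0   ⊔ z0   = z0
half ⊔ half = half
z1   ⊔ z1   = z1
_    ⊔ _    = half

∂ : Z → Z → Z
∂ x    half = half
∂ z0   z0   = z0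
∂ half z0   = z1
∂ z1   z0   = z1
∂ z0   z1   = z0
∂ half z1   = z0
∂ z1   z1   = z1

_⊓_ : Z → Z → Maybe Z
z0   ⊓ z0   = just z0
z0   ⊓ half = just z0
z0   ⊓ z1   = nothing
half ⊓ y    = just y
z1   ⊓ z0   = nothing
z1   ⊓ half = just z1
z1   ⊓ z1   = just z1

data Form (m : ℕ) : Set where
  var   : Fin m → Form m
  c0    : Form m
  chalf : Form m
  _⊔ᶠ_  : Form m → Form m → Form m
  ∂ᶠ    : Form m → Form m → Form m
  _∧ᶠ_  : Form m → Form m → Form m

eval : ∀ {m} → Form m → (Fin m → Z) → Z
eval (var i)   v = v i
eval c0        v = z0
eval chalf     v = half
eval (φ ⊔ᶠ ψ)  v = eval φ v ⊔ eval ψ v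
eval (∂ᶠ φ ψ)  v = ∂ (eval φ v) (eval ψ v)
eval (φ ∧ᶠ ψ)  v = eval φ v ∧ eval ψ v

-- Θ = {θ_1,…,θ_k}, k ≥ 1, given as a nonempty list
Incompatible : ∀ {m} → List⁺ (Form m) → Set
Incompatible {m} Θ =
  ∃[ v ] ∃[ θ₁ ] ∃[ θ₂ ]
    (θ₁ ∈ toList Θ × θ₂ ∈ toList Θ ×
     ((eval θ₁ v ≡ z0 × eval θ₂ v ≡ z1) ⊎ (eval θ₁ v ≡ z1 × eval θ₂ v ≡ z0)))

Compatible : ∀ {m} → List⁺ (Form m) → Set
Compatible Θ = ¬ Incompatible Θ

⊓-fold : List⁺ Z → Maybe Z
⊓-fold (x ∷ xs) = go x xs
  where
  go : Z → List Z → Maybe Z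
  go acc []       = just acc
  go acc (y ∷ ys) = (acc ⊓ y) >>= λ a → go a ys

meetAt : ∀ {m} → List⁺ (Form m) → (Fin m → Z) → Maybe Z
meetAt Θ v = ⊓-fold (Data.List.NonEmpty.map (λ θ → eval θ v) Θ)

-- Incompatibility only asks for a witness v ∈ 𝔷^m, and 𝔷^m is finite, so it is decided by
-- exhaustive search. For the second part, the partial meet ⊓ agrees on every non-clashing
-- pair with the term x ⊓′ y = ∂(x ∧ y, ∂(0,x) ∧ ∂(0,y)) of the signature; a compatible Θ is
-- pairwise non-clashing at every v, and ⊓′ of two values clashes with nothing that clashed
-- with neither, so folding ⊓′ over θ₁, …, θ_k computes the pointwise meet.
module Submission where

open import Defs
open import Data.Nat using (ℕ; _≥_; zero; suc)
open import Data.Fin using (Fin; zero; suc)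
open import Data.List using (List; []; _∷_; map; foldl)
open import Data.List.NonEmpty using (List⁺; _∷_; toList)
open import Data.List.Membership.Propositional using (_∈_; find; lose)
open import Data.List.Relation.Unary.Any as Any using (Any; here; there; any?; satisfied)
import Data.List.Relation.Unary.All as All
open All using (_∷_)
open import Data.List.Relation.Unary.AllPairs using (AllPairs; []; _∷_)
import Data.List.Relation.Unary.AllPairs.Properties as AllPairs
open import Data.Vec.Functional using (head; tail) renaming (_∷_ to _◂_)
open import Data.Maybe using (just)
open import Data.Product using (Σ; ∃; _×_; _,_)
open import Data.Sum using (_⊎_; inj₁; inj₂; [_,_])
open import Function using (_∘_; _⇔_; mk⇔)
open import Relation.Binary.PropositionalEquality
  using (_≡_; refl; cong; cong₂; subst₂; _≗_; module ≡-Reasoning)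
open import Relation.Nullary using (Dec; yes; no; ¬_; contradiction)
open import Relation.Nullary.Decidable as Dec using (map′)

data Clash : Z → Z → Set where
  0-1 : Clash z0 z1
  1-0 : Clash z1 z0

clash? : ∀ x y → Dec (Clash x y)
clash? z0   z0   = no λ ()
clash? z0   half = no λ ()
clash? z0   z1   = yes 0-1
clash? half _    = no λ ()
clash? z1   z0   = yes 1-0
clash? z1   half = no λ ()
clash? z1   z1   = no λ ()

toClash : ∀ {x y} → (x ≡ z0 × y ≡ z1) ⊎ (x ≡ z1 × y ≡ z0) → Clash x y
toClash (inj₁ (refl , refl)) = 0-1
toClash (inj₂ (refl , refl)) = 1-0

fromClash : ∀ {x y} → Clash x y → (x ≡ z0 × y ≡ z1) ⊎ (x ≡ z1 × y ≡ z0)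
fromClash 0-1 = inj₁ (refl , refl)
fromClash 1-0 = inj₂ (refl , refl)

module _ {A : Set} {elems : List A} (complete : ∀ a → a ∈ elems) where

  ∃-vector? : ∀ {n} {P : (Fin n → A) → Set} →
              (∀ {v w} → v ≗ w → P v → P w) → (∀ v → Dec (P v)) → Dec (∃ P)
  ∃-vector? {zero} resp P? = map′ (_ ,_) (λ (v , p) → resp (λ ()) p) (P? (λ ()))
  ∃-vector? {suc n} {P} resp P? =
    map′ (λ (any : Any (λ a → ∃ λ w → P (a ◂ w)) elems) →
           let a , w , p = satisfied any in a ◂ w , p)
         (λ (v , p) → lose (complete (head v)) (tail v , resp head◂tail p))
         (any? ∃-tail? elems)
    where
    head◂tail : ∀ {v : Fin (suc n) → A} → v ≗ head v ◂ tail v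
    head◂tail zero    = refl
    head◂tail (suc i) = refl

    ◂-cong : ∀ {a} {v w : Fin n → A} → v ≗ w → a ◂ v ≗ a ◂ w
    ◂-cong v≗w zero    = refl
    ◂-cong v≗w (suc i) = v≗w i

    ∃-tail? : ∀ a → Dec (∃ λ w → P (a ◂ w))
    ∃-tail? a = ∃-vector? (λ v≗w → resp (◂-cong v≗w)) (P? ∘ (a ◂_))

Z-complete : ∀ x → x ∈ z0 ∷ half ∷ z1 ∷ []
Z-complete z0   = here refl
Z-complete half = there (here refl)
Z-complete z1   = there (there (here refl))

eval-cong : ∀ {m} (φ : Form m) {v w : Fin m → Z} → v ≗ w → eval φ v ≡ eval φ w
eval-cong (var i)  v≗w = v≗w i
eval-cong c0       v≗w = refl
eval-cong chalf    v≗w = refl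
eval-cong (φ ⊔ᶠ ψ) v≗w = cong₂ _⊔_ (eval-cong φ v≗w) (eval-cong ψ v≗w)
eval-cong (∂ᶠ φ ψ) v≗w = cong₂ ∂ (eval-cong φ v≗w) (eval-cong ψ v≗w)
eval-cong (φ ∧ᶠ ψ) v≗w = cong₂ _∧_ (eval-cong φ v≗w) (eval-cong ψ v≗w)

ClashesAt : ∀ {m} → List (Form m) → (Fin m → Z) → Set
ClashesAt Θ v = Any (λ θ₁ → Any (λ θ₂ → Clash (eval θ₁ v) (eval θ₂ v)) Θ) Θ

ClashesAt-resp-≗ : ∀ {m} (Θ : List (Form m)) {v w} → v ≗ w → ClashesAt Θ v → ClashesAt Θ w
ClashesAt-resp-≗ Θ v≗w =
  Any.map λ {θ₁} → Any.map λ {θ₂} →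
    subst₂ Clash (eval-cong θ₁ v≗w) (eval-cong θ₂ v≗w)

∃-clashesAt⇔incompatible : ∀ {m} (Θ : List⁺ (Form m)) → ∃ (ClashesAt (toList Θ)) ⇔ Incompatible Θ
∃-clashesAt⇔incompatible Θ = mk⇔
  (λ (v , clashes) →
    let θ₁ , θ₁∈ , clashes₁ = find clashes
        θ₂ , θ₂∈ , c        = find clashes₁
    in v , θ₁ , θ₂ , θ₁∈ , θ₂∈ , fromClash c)
  (λ (v , θ₁ , θ₂ , θ₁∈ , θ₂∈ , c) → v , lose θ₁∈ (lose θ₂∈ (toClash c)))

incompatible? : ∀ {m} (Θ : List⁺ (Form m)) → Dec (Incompatible Θ)
incompatible? Θ = Dec.map (∃-clashesAt⇔incompatible Θ)
  (∃-vector? Z-complete (ClashesAt-resp-≗ L)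
     (λ v → any? (λ θ₁ → any? (λ θ₂ → clash? (eval θ₁ v) (eval θ₂ v)) L) L))
  where L = toList Θ

-- ∂(0,x) ∧ ∂(0,y) is 1/2 if x = y = 1/2 and 0 otherwise, and ∂(a,0) is 0 iff a = 0.
_⊓′_ : Z → Z → Z
x ⊓′ y = ∂ (x ∧ y) (∂ z0 x ∧ ∂ z0 y)

NoClash : Z → Z → Set
NoClash x y = ¬ Clash x y

⊓-total : ∀ {x y} → NoClash x y → x ⊓ y ≡ just (x ⊓′ y)
⊓-total {z0}   {z0}   _  = refl
⊓-total {z0}   {half} _  = refl
⊓-total {z0}   {z1}   nc = contradiction 0-1 nc
⊓-total {half} {z0}   _  = refl
⊓-total {half} {half} _  = refl
⊓-total {half} {z1}   _  = refl
⊓-total {z1}   {z0}   nc = contradiction 1-0 nc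
⊓-total {z1}   {half} _  = refl
⊓-total {z1}   {z1}   _  = refl

⊓′-clash : ∀ x y {z} → Clash (x ⊓′ y) z → Clash x y ⊎ Clash x z ⊎ Clash y z
⊓′-clash z0   z0   0-1 = inj₂ (inj₁ 0-1)
⊓′-clash z0   half 0-1 = inj₂ (inj₁ 0-1)
⊓′-clash z0   z1   _   = inj₁ 0-1
⊓′-clash half z0   0-1 = inj₂ (inj₂ 0-1)
⊓′-clash half half ()
⊓′-clash half z1   1-0 = inj₂ (inj₂ 1-0)
⊓′-clash z1   z0   _   = inj₁ 1-0
⊓′-clash z1   half 1-0 = inj₂ (inj₁ 1-0)
⊓′-clash z1   z1   1-0 = inj₂ (inj₁ 1-0)

⊓′-noClash : ∀ {x y z} → NoClash x y → NoClash x z → NoClash y z → NoClash (x ⊓′ y) z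
⊓′-noClash {x} {y} x≁y x≁z y≁z c = [ x≁y , [ x≁z , y≁z ] ] (⊓′-clash x y c)

⊓-fold-total : ∀ {x xs} → AllPairs NoClash (x ∷ xs) → ⊓-fold (x ∷ xs) ≡ just (foldl _⊓′_ x xs)
⊓-fold-total {xs = []} _ = refl
⊓-fold-total {xs = _ ∷ _} ((x≁y ∷ x≁ys) ∷ y≁ys ∷ pairwise) rewrite ⊓-total x≁y =
  ⊓-fold-total (All.zipWith (λ (x≁z , y≁z) → ⊓′-noClash x≁y x≁z y≁z) (x≁ys , y≁ys) ∷ pairwise)

AllPairs-tabulate : ∀ {A : Set} {R : A → A → Set} {xs : List A} →
                    (∀ {x y} → x ∈ xs → y ∈ xs → R x y) → AllPairs R xs
AllPairs-tabulate {xs = []}    _   = []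
AllPairs-tabulate {xs = _ ∷ _} R∈ =
  All.tabulate (R∈ (here refl) ∘ there) ∷ AllPairs-tabulate (λ x∈ y∈ → R∈ (there x∈) (there y∈))

compatible⇒noClash : ∀ {m} (Θ : List⁺ (Form m)) → Compatible Θ →
                     ∀ v → AllPairs NoClash (map (λ θ → eval θ v) (toList Θ))
compatible⇒noClash Θ compatible v =
  AllPairs.map⁺ (AllPairs-tabulate λ θ₁∈ θ₂∈ c →
    compatible (v , _ , _ , θ₁∈ , θ₂∈ , fromClash c))

_⊓ᶠ_ : ∀ {m} → Form m → Form m → Form m
φ ⊓ᶠ ψ = ∂ᶠ (φ ∧ᶠ ψ) (∂ᶠ c0 φ ∧ᶠ ∂ᶠ c0 ψ)

⨅ᶠ : ∀ {m} → List⁺ (Form m) → Form m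
⨅ᶠ (θ ∷ θs) = foldl _⊓ᶠ_ θ θs

eval-foldl-⊓ᶠ : ∀ {m} (φ : Form m) ψs v →
                eval (foldl _⊓ᶠ_ φ ψs) v ≡ foldl _⊓′_ (eval φ v) (map (λ ψ → eval ψ v) ψs)
eval-foldl-⊓ᶠ φ []       v = refl
eval-foldl-⊓ᶠ φ (ψ ∷ ψs) v = eval-foldl-⊓ᶠ (φ ⊓ᶠ ψ) ψs v

meetAt-⨅ᶠ : ∀ {m} (Θ : List⁺ (Form m)) → Compatible Θ →
            ∀ v → meetAt Θ v ≡ just (eval (⨅ᶠ Θ) v)
meetAt-⨅ᶠ Θ@(θ ∷ θs) compatible v = begin
  meetAt Θ v                                             ≡⟨ ⊓-fold-total (compatible⇒noClash Θ compatible v) ⟩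
  just (foldl _⊓′_ (eval θ v) (map (λ ψ → eval ψ v) θs)) ≡⟨ cong just (eval-foldl-⊓ᶠ θ θs v) ⟨
  just (eval (⨅ᶠ Θ) v)                                   ∎
  where open ≡-Reasoning

proposition5p9 : (m : ℕ) → m ≥ 1 →
    ((Θ : List⁺ (Form m)) → Dec (Incompatible Θ))
    × ((Θ : List⁺ (Form m)) → Compatible Θ →
    Σ (Form m) (λ ω → (v : Fin m → Z) → meetAt Θ v ≡ just (eval ω v)))
proposition5p9 _ _ = incompatible? , λ Θ compatible → ⨅ᶠ Θ , meetAt-⨅ᶠ Θ compatible
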